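{- Let $2k+1$ be a prime and let $G$ and $H$ be finite simple graphs. If $H$ admits a $(2k+1)$-neighborhood balanced coloring in which every color class has the same size (i.e. $\sigma(R_i)=\sigma(R_j)$ for all $i,j$), then the lexicographic product $G[H]$ admits a $(2k+1)$-neighborhood balanced coloring.
   Context: For a prime $2k+1$ (with $k\ge 1$), a $(2k+1)$-neighborhood balanced coloring of a finite simple graph is an assignment to each vertex of one of $2k+1$ colors $R_1,\dots,R_{2k+1}$ such that every vertex has an equal number of neighbors of each color; $\sigma(R_i)$ is the number of vertices colored $R_i$. The lexicographic product $G[H]$ has vertex set $V(G)\times V(H)$, with $(u,v)$ and $(u',v')$ adjacent if and only if either $uu'\in E(G)$, or $u=u'$ and $vv'\in E(H)$. -}

module Defs where

open import Data.Nat using (ℕ; suc; _+_; _*_)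
open import Data.Bool using (Bool; true; false; _∨_; _∧_; T)
open import Data.Fin using (Fin; remQuot; _≟_)
open import Data.Fin.Properties using () renaming (_≟_ to _≟ᶠ_)
open import Data.Product using (_×_; proj₁; proj₂; Σ)
open import Data.List using (List; length; filter)
open import Data.List using () renaming (allFin to allFinL)
open import Data.List.Base using ()
open import Relation.Nullary.Decidable using (⌊_⌋)
open import Relation.Binary.PropositionalEquality using (_≡_; refl) renaming (sym to ≡sym)
open import Relation.Nullary using (yes; no)
open import Data.Empty using (⊥-elim)

record Graph (n : ℕ) : Set where
  field
    adj   : Fin n → Fin n → Bool
    sym   : ∀ u v → adj u v ≡ adj v u
    irrefl : ∀ v → adj v v ≡ false
open Graph public

countFin : (n : ℕ) → (Fin n → Bool) → ℕ
countFin n p = length (filter (λ u → T? (p u)) (Data.List.allFin n))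
  where open import Data.Bool using (T?)

Coloring : ℕ → ℕ → Set
Coloring n c = Fin n → Fin c

nbrCount : ∀ {n c} → Graph n → Coloring n c → Fin n → Fin c → ℕ
nbrCount {n} G col v i = countFin n (λ u → adj G v u ∧ ⌊ col u ≟ᶠ i ⌋)

σ : ∀ {n c} → Coloring n c → Fin c → ℕ
σ {n} col i = countFin n (λ u → ⌊ col u ≟ᶠ i ⌋)

IsNBC : ∀ {n c} → Graph n → Coloring n c → Set
IsNBC G col = ∀ v i j → nbrCount G col v i ≡ nbrCount G col v j

HasNBC : ∀ {n} → ℕ → Graph n → Set
HasNBC {n} c G = Σ (Coloring n c) (λ col → IsNBC G col)

HasEqualNBC : ∀ {n} → ℕ → Graph n → Set
HasEqualNBC {n} c G =
  Σ (Coloring n c) (λ col → IsNBC G col × (∀ i j → σ col i ≡ σ col j))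

-- Lexicographic product G[H] on Fin (m * n); vertex (u , v) is encoded
-- by Data.Fin.combine u v, decoded by remQuot.
lexAdj : ∀ {m n} → Graph m → Graph n → Fin (m * n) → Fin (m * n) → Bool
lexAdj {m} {n} G H x y =
  adj G (proj₁ (remQuot {m} n x)) (proj₁ (remQuot {m} n y))
  ∨ (⌊ proj₁ (remQuot {m} n x) ≟ᶠ proj₁ (remQuot {m} n y) ⌋
     ∧ adj H (proj₂ (remQuot {m} n x)) (proj₂ (remQuot {m} n y)))

private
  ∨-comm' : ∀ a b → a ∨ b ≡ b ∨ a
  ∨-comm' false false = refl
  ∨-comm' false true = refl
  ∨-comm' true false = refl
  ∨-comm' true true = refl

  eqb-sym : ∀ {k} (a b : Fin k) → ⌊ a ≟ᶠ b ⌋ ≡ ⌊ b ≟ᶠ a ⌋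
  eqb-sym a b with a ≟ᶠ b | b ≟ᶠ a
  ... | yes _ | yes _ = refl
  ... | no _ | no _ = refl
  ... | yes p | no q = ⊥-elim (q (≡sym p))
  ... | no p | yes q = ⊥-elim (p (≡sym q))

  eqb-refl : ∀ {k} (a : Fin k) → ⌊ a ≟ᶠ a ⌋ ≡ true
  eqb-refl a with a ≟ᶠ a
  ... | yes _ = refl
  ... | no p = ⊥-elim (p refl)

lexSym : ∀ {m n} (G : Graph m) (H : Graph n) x y → lexAdj G H x y ≡ lexAdj G H y x
lexSym {m} {n} G H x y
  rewrite sym G (proj₁ (remQuot {m} n x)) (proj₁ (remQuot {m} n y))
        | eqb-sym (proj₁ (remQuot {m} n x)) (proj₁ (remQuot {m} n y))
        | sym H (proj₂ (remQuot {m} n x)) (proj₂ (remQuot {m} n y)) = refl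

lexIrrefl : ∀ {m n} (G : Graph m) (H : Graph n) x → lexAdj G H x x ≡ false
lexIrrefl {m} {n} G H x
  rewrite irrefl G (proj₁ (remQuot {m} n x))
        | eqb-refl (proj₁ (remQuot {m} n x))
        | irrefl H (proj₂ (remQuot {m} n x)) = refl

_[_]ˡ : ∀ {m n} → Graph m → Graph n → Graph (m * n)
G [ H ]ˡ = record { adj = lexAdj G H ; sym = lexSym G H ; irrefl = lexIrrefl G H }

-- Colour the vertex (u , v) of G[H] with the colour of v in H. For a vertex (u₀ , v₀),
-- the neighbours of colour i in the copy {u} × V(H) are all vertices of colour i there
-- when u₀u ∈ E(G) (σ(i) many), the H-neighbours of v₀ of colour i when u = u₀, and none
-- otherwise. Each of these counts is independent of i, hence so is their sum over u.
module Submission where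

open import Defs hiding (sym)
open import Data.Nat using (ℕ; zero; suc; _+_; _*_; _≥_)
open import Data.Nat.Properties using (+-assoc; +-0-monoid)
open import Data.Nat.Primality using (Prime)
open import Data.Bool using (Bool; true; false; _∨_; _∧_; T?)
open import Data.Fin using (Fin; combine; remQuot; _↑ˡ_; _↑ʳ_)
open import Data.Fin.Properties using (remQuot-combine) renaming (_≟_ to _≟ᶠ_)
open import Data.Product using (_×_; _,_; proj₁; proj₂)
open import Data.List using (length; filter; tabulate)
open import Relation.Nullary.Decidable using (⌊_⌋)
open import Relation.Binary.PropositionalEquality using (_≡_; refl; sym; cong; module ≡-Reasoning)
open import Function using (_∘_)
open import Algebra.Properties.Monoid.Sum +-0-monoid using (sum-syntax; sum-cong-≗)

open ≡-Reasoning

indicator : Bool → ℕ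
indicator true  = 1
indicator false = 0

length-filter-tabulate : ∀ {A : Set} n (f : Fin n → A) (p : A → Bool) →
  length (filter (T? ∘ p) (tabulate f)) ≡ ∑[ i < n ] indicator (p (f i))
length-filter-tabulate zero    f p = refl
length-filter-tabulate (suc n) f p with p (f Fin.zero)
... | true  = cong suc (length-filter-tabulate n (f ∘ Fin.suc) p)
... | false = length-filter-tabulate n (f ∘ Fin.suc) p

countFin≡∑ : ∀ n (p : Fin n → Bool) → countFin n p ≡ ∑[ i < n ] indicator (p i)
countFin≡∑ n p = length-filter-tabulate n (λ i → i) p

∑-↑ : ∀ a b (f : Fin (a + b) → ℕ) →
  ∑[ x < a + b ] f x ≡ ∑[ i < a ] f (i ↑ˡ b) + ∑[ j < b ] f (a ↑ʳ j)
∑-↑ zero    b f = refl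
∑-↑ (suc a) b f = begin
  f Fin.zero + ∑[ x < a + b ] f (Fin.suc x)
    ≡⟨ cong (f Fin.zero +_) (∑-↑ a b (f ∘ Fin.suc)) ⟩
  f Fin.zero + (∑[ i < a ] f (Fin.suc (i ↑ˡ b)) + ∑[ j < b ] f (suc a ↑ʳ j))
    ≡⟨ sym (+-assoc (f Fin.zero) _ _) ⟩
  f Fin.zero + ∑[ i < a ] f (Fin.suc (i ↑ˡ b)) + ∑[ j < b ] f (suc a ↑ʳ j) ∎

∑-combine : ∀ m n (f : Fin (m * n) → ℕ) →
  ∑[ x < m * n ] f x ≡ ∑[ u < m ] ∑[ v < n ] f (combine u v)
∑-combine zero    n f = refl
∑-combine (suc m) n f = begin
  ∑[ x < n + m * n ] f x
    ≡⟨ ∑-↑ n (m * n) f ⟩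
  ∑[ v < n ] f (v ↑ˡ m * n) + ∑[ x < m * n ] f (n ↑ʳ x)
    ≡⟨ cong (∑[ v < n ] f (v ↑ˡ m * n) +_) (∑-combine m n (f ∘ (n ↑ʳ_))) ⟩
  ∑[ v < n ] f (v ↑ˡ m * n) + ∑[ u < m ] ∑[ v < n ] f (n ↑ʳ combine u v) ∎

countFin-remQuot : ∀ m n (p : Fin m × Fin n → Bool) →
  countFin (m * n) (p ∘ remQuot n) ≡ ∑[ u < m ] countFin n (λ v → p (u , v))
countFin-remQuot m n p = begin
  countFin (m * n) (p ∘ remQuot n)
    ≡⟨ countFin≡∑ (m * n) _ ⟩
  ∑[ x < m * n ] indicator (p (remQuot n x))
    ≡⟨ ∑-combine m n _ ⟩
  ∑[ u < m ] ∑[ v < n ] indicator (p (remQuot n (combine u v)))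
    ≡⟨ sum-cong-≗ (λ u → sum-cong-≗ (λ v → cong (indicator ∘ p) (remQuot-combine u v))) ⟩
  ∑[ u < m ] ∑[ v < n ] indicator (p (u , v))
    ≡⟨ sum-cong-≗ {m} (λ u → sym (countFin≡∑ n _)) ⟩
  ∑[ u < m ] countFin n (λ v → p (u , v)) ∎

liftColoring : ∀ m {n c} → Coloring n c → Coloring (m * n) c
liftColoring m {n} col = col ∘ proj₂ ∘ remQuot {m} n

lex-isNBC : ∀ {m n c} (G : Graph m) (H : Graph n) (col : Coloring n c) →
  IsNBC H col → (∀ i j → σ col i ≡ σ col j) → IsNBC (G [ H ]ˡ) (liftColoring m col)
lex-isNBC {m} {n} G H col nbc equal-σ x i j = begin
  nbrCount (G [ H ]ˡ) (liftColoring m col) x i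
    ≡⟨ countFin-remQuot m n (adjacentOfColour i) ⟩
  ∑[ u < m ] countFin n (λ v → adjacentOfColour i (u , v))
    ≡⟨ sum-cong-≗ (λ u → block-balanced (adj G u₀ u) ⌊ u₀ ≟ᶠ u ⌋) ⟩
  ∑[ u < m ] countFin n (λ v → adjacentOfColour j (u , v))
    ≡⟨ sym (countFin-remQuot m n (adjacentOfColour j)) ⟩
  nbrCount (G [ H ]ˡ) (liftColoring m col) x j ∎
  where
  u₀ = proj₁ (remQuot {m} n x)
  v₀ = proj₂ (remQuot {m} n x)

  adjacentOfColour : Fin _ → Fin m × Fin n → Bool
  adjacentOfColour k (u , v) = (adj G u₀ u ∨ (⌊ u₀ ≟ᶠ u ⌋ ∧ adj H v₀ v)) ∧ ⌊ col v ≟ᶠ k ⌋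

  block-balanced : ∀ a b →
    countFin n (λ v → (a ∨ (b ∧ adj H v₀ v)) ∧ ⌊ col v ≟ᶠ i ⌋)
    ≡ countFin n (λ v → (a ∨ (b ∧ adj H v₀ v)) ∧ ⌊ col v ≟ᶠ j ⌋)
  block-balanced true  _     = equal-σ i j
  block-balanced false true  = nbc v₀ i j
  block-balanced false false = refl

lex-hasNBC : ∀ {m n} c (G : Graph m) (H : Graph n) → HasEqualNBC c H → HasNBC c (G [ H ]ˡ)
lex-hasNBC {m} c G H (col , nbc , equal-σ) = liftColoring m col , lex-isNBC G H col nbc equal-σ

theorem2p8 : (k : ℕ) → k ≥ 1 → Prime (2 * k + 1)
    → (m n : ℕ) (G : Graph m) (H : Graph n)
    → HasEqualNBC (2 * k + 1) H
    → HasNBC (2 * k + 1) (G [ H ]ˡ)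
theorem2p8 k _ _ m n = lex-hasNBC (2 * k + 1)
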